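{- Let $\Sigma,\Gamma$ be as in the context, $t\geq1$, and let $\alpha$ be a $\Box$-free normal $t$-formula. Then $\mathrm M_{\mathbf I,t}(\alpha)=\mathrm M_{\mathbf J,t}(\alpha)$ for all streams $\mathbf I$ and $\mathbf J$; consequently $\mathrm M_{\mathbf I,t}(\alpha)=\mathrm{MM}_{\mathbf I,t}(\alpha)$ for every stream $\mathbf I$.
   Context: $\Sigma$ is a finite nonempty set of propositional atoms containing a special symbol $\top$. Formulas: $\alpha::=a\mid\neg\alpha\mid\alpha\land\alpha\mid\alpha\lor\alpha\mid\alpha\rightarrow\alpha\mid\Diamond\alpha\mid\Box\alpha\mid @_{t'}\alpha\mid\boxplus_{[\ell,r]}\alpha$ with $a\in\Sigma$, integer $t'\geq1$, $\ell,r\in\mathbb N\cup\{\infty\}$, $\ell\leq r$. Normal: none of $\neg,\lor,\rightarrow,\Diamond$; $\Box$-free: no $\Box$. A stream is $\mathbf I=I_1I_2\ldots$ with $I_s\subseteq\Sigma$; $\cup$ pointwise; $\emptyset$ all-empty; $\{a\}_s$ has $\{a\}$ at $s$, $\emptyset$ elsewhere. $\mathrm{supp}\,\mathbf I$: tightest interval containing $\{s\mid I_s\neq\emptyset\}$, $\mathrm{supp}\,\emptyset=\emptyset$. $\mathbf I[\ell,r;s]$ agrees with $\mathbf I$ at $u$ with $s-\ell\leq u\leq s+r$, empty elsewhere. Fix $\Gamma\subseteq\Sigma$. Entailment: $\mathbf I,s\models_\Gamma\top$; for $a\neq\top$, $\mathbf I,s\models_\Gamma a$ iff $a\in I_s\cup\Gamma$;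 $\neg,\land,\lor,\rightarrow$ classically; $\Diamond\alpha$/$\Box\alpha$ at $s$ iff $\alpha$ at some/every $s'\in\mathrm{supp}\,\mathbf I$; $@_{s'}\alpha$ at $s$ iff $\alpha$ at $s'$; $\mathbf I,s\models_\Gamma\boxplus_{[\ell,r]}\alpha$ iff $\mathbf I[\ell,r;s],s\models_\Gamma\alpha$. A normal $t$-formula is a normal formula having some stream satisfying it at $t$. Partial model operator: $\mathrm M_{\mathbf I,s}(a)=\{a\}_s$ if $a\notin\Gamma$, $\emptyset$ if $a\in\Gamma$; $\mathrm M_{\mathbf I,s}(\alpha\land\beta)=\mathrm M_{\mathbf I,s}(\alpha)\cup\mathrm M_{\mathbf I,s}(\beta)$; $\mathrm M_{\mathbf I,s}(\Box\alpha)=\bigcup_{s'\in\mathrm{supp}\,\mathbf I}\mathrm M_{\mathbf I,s'}(\alpha)$; $\mathrm M_{\mathbf I,s}(@_{s'}\alpha)=\mathrm M_{\mathbf I,s'}(\alpha)$; $\mathrm M_{\mathbf I,s}(\boxplus_{[\ell,r]}\alpha)=\mathrm M_{\mathbf I[\ell,r;s],s}(\alpha)$. $\mathrm{MM}_{\mathbf I,s}(\alpha)=\mathrm M_{\mathrm M_{\mathbf I,s}(\alpha),s}(\alpha)$. -}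

module Defs where

open import Data.Nat using (ℕ; _+_; _≤_)
open import Data.Fin using (Fin; _≟_)
open import Data.Fin.Subset using (Subset; _∈_; _∉_)
open import Data.Product using (_×_; Σ-syntax; ∃-syntax)
open import Data.Sum using (_⊎_)
open import Data.Unit.Polymorphic using (⊤)
open import Data.Empty.Polymorphic using (⊥)
open import Relation.Nullary using (¬_; yes; no)
open import Relation.Binary.PropositionalEquality using (_≡_)
open import Level using (0ℓ)

-- READING: atoms Σ = Fin n, with a designated element `top` (the symbol ⊤).
-- Time points: the paper's time point k ≥ 1 is represented by the natural
-- number k - 1 (so time 0 here is the paper's time 1).

data ℕ∞ : Set where
  fin : ℕ → ℕ∞
  ∞   : ℕ∞

data _≤∞_ : ℕ∞ → ℕ∞ → Set where
  fin≤fin : ∀ {m k} → m ≤ k → fin m ≤∞ fin k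
  _≤∞∞    : ∀ x → x ≤∞ ∞

data Fm (n : ℕ) : Set where
  atom : Fin n → Fm n
  ¬′   : Fm n → Fm n
  _∧′_ : Fm n → Fm n → Fm n
  _∨′_ : Fm n → Fm n → Fm n
  _⇒′_ : Fm n → Fm n → Fm n
  ◇    : Fm n → Fm n
  □    : Fm n → Fm n
  at   : ℕ → Fm n → Fm n
  ⊞    : (ℓ r : ℕ∞) → ℓ ≤∞ r → Fm n → Fm n

data Normal {n : ℕ} : Fm n → Set where
  atom : ∀ a → Normal (atom a)
  _∧′_ : ∀ {α β} → Normal α → Normal β → Normal (α ∧′ β)
  □    : ∀ {α} → Normal α → Normal (□ α)
  at   : ∀ {t α} → Normal α → Normal (at t α)
  ⊞    : ∀ {ℓ r p α} → Normal α → Normal (⊞ ℓ r p α)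

data BoxFree {n : ℕ} : Fm n → Set where
  atom : ∀ a → BoxFree (atom a)
  ¬′   : ∀ {α} → BoxFree α → BoxFree (¬′ α)
  _∧′_ : ∀ {α β} → BoxFree α → BoxFree β → BoxFree (α ∧′ β)
  _∨′_ : ∀ {α β} → BoxFree α → BoxFree β → BoxFree (α ∨′ β)
  _⇒′_ : ∀ {α β} → BoxFree α → BoxFree β → BoxFree (α ⇒′ β)
  ◇    : ∀ {α} → BoxFree α → BoxFree (◇ α)
  at   : ∀ {t α} → BoxFree α → BoxFree (at t α)
  ⊞    : ∀ {ℓ r p α} → BoxFree α → BoxFree (⊞ ℓ r p α)

Stream : ℕ → Set₁
Stream n = ℕ → Fin n → Set

_≐_ : ∀ {n} → Stream n → Stream n → Set
I ≐ J = ∀ u a → (I u a → J u a) × (J u a → I u a)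

∅ : ∀ {n} → Stream n
∅ u a = ⊥

_∪_ : ∀ {n} → Stream n → Stream n → Stream n
(I ∪ J) u a = I u a ⊎ J u a

single : ∀ {n} → Fin n → ℕ → Stream n
single a s u b = (u ≡ s) × (b ≡ a)

NonEmptyAt : ∀ {n} → Stream n → ℕ → Set
NonEmptyAt I u = ∃[ a ] I u a

-- s ∈ supp I  (supp I is the tightest interval containing the nonempty points)
InSupp : ∀ {n} → Stream n → ℕ → Set
InSupp I s = (∃[ u ] (u ≤ s × NonEmptyAt I u)) × (∃[ v ] (s ≤ v × NonEmptyAt I v))

-- window condition s - ℓ ≤ u ≤ s + r (with ℓ, r possibly ∞)
LowerOK : ℕ∞ → ℕ → ℕ → Set
LowerOK (fin ℓ) s u = s ≤ u + ℓ
LowerOK ∞       s u = ⊤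

UpperOK : ℕ∞ → ℕ → ℕ → Set
UpperOK (fin r) s u = u ≤ s + r
UpperOK ∞       s u = ⊤

window : ∀ {n} → Stream n → ℕ∞ → ℕ∞ → ℕ → Stream n
window I ℓ r s u a = LowerOK ℓ s u × UpperOK r s u × I u a

Sat : ∀ {n} → (top : Fin n) → (Γ : Subset n) → Stream n → ℕ → Fm n → Set
Sat top Γ I s (atom a) with a ≟ top
... | yes _ = ⊤
... | no  _ = I s a ⊎ a ∈ Γ
Sat top Γ I s (¬′ α) = ¬ Sat top Γ I s α
Sat top Γ I s (α ∧′ β) = Sat top Γ I s α × Sat top Γ I s β
Sat top Γ I s (α ∨′ β) = Sat top Γ I s α ⊎ Sat top Γ I s β
Sat top Γ I s (α ⇒′ β) = Sat top Γ I s α → Sat top Γ I s β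
Sat top Γ I s (◇ α) = ∃[ s′ ] (InSupp I s′ × Sat top Γ I s′ α)
Sat top Γ I s (□ α) = ∀ s′ → InSupp I s′ → Sat top Γ I s′ α
Sat top Γ I s (at s′ α) = Sat top Γ I s′ α
Sat top Γ I s (⊞ ℓ r _ α) = Sat top Γ (window I ℓ r s) s α

NormalTFormula : ∀ {n} → Fin n → Subset n → ℕ → Fm n → Set₁
NormalTFormula top Γ t α = Normal α × Σ[ I ∈ Stream _ ] Sat top Γ I t α

-- partial model operator M_{I,s}(α) (defined on normal formulas; the other
-- connectives are given the value ∅, they never occur in normal formulas)
M : ∀ {n} → Subset n → Stream n → ℕ → Fm n → Stream n
M Γ I s (atom a) u b = (a ∉ Γ) × single a s u b
M Γ I s (α ∧′ β) = M Γ I s α ∪ M Γ I s β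
M Γ I s (□ α) u b = ∃[ s′ ] (InSupp I s′ × M Γ I s′ α u b)
M Γ I s (at s′ α) = M Γ I s′ α
M Γ I s (⊞ ℓ r _ α) = M Γ (window I ℓ r s) s α
M Γ I s (¬′ α) = ∅
M Γ I s (α ∨′ β) = ∅
M Γ I s (α ⇒′ β) = ∅
M Γ I s (◇ α) = ∅

MM : ∀ {n} → Subset n → Stream n → ℕ → Fm n → Stream n
MM Γ I s α = M Γ (M Γ I s α) s α

module Submission where

open import Defs
open import Data.Nat using (ℕ)
open import Data.Fin using (Fin)
open import Data.Fin.Subset using (Subset)
open import Data.Product using (_×_; _,_)
open import Data.Sum using (map)
open import Function using (id)

-- Only □ reads the stream (through supp I); every other clause of M just
-- passes it on, possibly windowed. So on □-free formulas M ignores the stream,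
-- and MM, which merely replaces the stream by M's own output, agrees with M.

∪-cong : ∀ {n} {I I′ J J′ : Stream n} → I ≐ I′ → J ≐ J′ → (I ∪ J) ≐ (I′ ∪ J′)
∪-cong I≐I′ J≐J′ u a with I≐I′ u a | J≐J′ u a
... | to , from | to′ , from′ = map to to′ , map from from′

M-stream-independent : ∀ {n} (Γ : Subset n) {α : Fm n} → Normal α → BoxFree α →
  ∀ (I J : Stream n) s → M Γ I s α ≐ M Γ J s α
M-stream-independent Γ (atom a) _ I J s u b = id , id
M-stream-independent Γ (nα ∧′ nβ) (bα ∧′ bβ) I J s =
  ∪-cong (M-stream-independent Γ nα bα I J s) (M-stream-independent Γ nβ bβ I J s)
M-stream-independent Γ (□ _) () I J s
M-stream-independent Γ (at nα) (at bα) I J _ = M-stream-independent Γ nα bα I J _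
M-stream-independent Γ (⊞ {ℓ} {r} nα) (⊞ bα) I J s =
  M-stream-independent Γ nα bα (window I ℓ r s) (window J ℓ r s) s

proposition2 : ∀ {n} (top : Fin n) (Γ : Subset n) (t : ℕ) (α : Fm n) →
    NormalTFormula top Γ t α → BoxFree α →
    (∀ (I J : Stream n) → M Γ I t α ≐ M Γ J t α) × (∀ (I : Stream n) → M Γ I t α ≐ MM Γ I t α)
proposition2 top Γ t α (normal , _) boxFree =
  (λ I J → independent I J t) , (λ I → independent I (M Γ I t α) t)
  where
  independent : ∀ (I J : Stream _) s → M Γ I s α ≐ M Γ J s α
  independent = M-stream-independent Γ normal boxFree
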